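{- Let $(a_n,b_n)$, $n\ge1$, be the $P$-positions $(x,y)$ with $0<x\le y$ of Corner the 2-Queen Dee, listed so that $a_1<a_2<\cdots$. Let $\mathbf t=\lim_{m\to\infty}\tau^m(a)$ be the Tribonacci word, the fixed point of the morphism $\tau(a)=ab$, $\tau(b)=ac$, $\tau(c)=a$, and let $\mathbf t_b$ be the infinite word obtained from $\mathbf t$ by deleting all occurrences of the letter $b$. Index the letters of $\mathbf t_b$ by $1,2,3,\ldots$. Then for every $n\ge1$, $a_n$ is the position of the $n$-th occurrence of $a$ in $\mathbf t_b$, and $b_n$ is the position of the $n$-th occurrence of $c$ in $\mathbf t_b$.
   Context: Positions are pairs $(x,y)$ of nonnegative integers. From $(x,y)$ the 2-Queen Dee may move to any position different from $(x,y)$ among: (i) $(x',y)$ with $0\le x'<x$, or $(x,y')$ with $0\le y'<y$; (ii) for each starting point $(u,v)\in\{(x,y),(x-1,y),(x,y-1)\}$ with $u,v\ge0$: the positions $(u-s,v-s)$ with $0\le s\le\min(u,v)$, and, if $u<v$, the positions $(t,v-u-t)$ with $0<t\le v-u$, and, if $u>v$, the positions $(u-v-t,t)$ with $0<t\le u-v$. Every move strictly decreases $x+y$. $P$-positions: $(0,0)$ is a $P$-position, and a position is a $P$-position iff it has no move to a $P$-position. -}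

module Defs where

open import Data.Nat using (ℕ; zero; suc; _+_; _∸_; _≤_; _<_)
open import Data.List using (List; []; _∷_; _++_; concatMap; filter)
open import Data.Product using (_×_)
open import Relation.Binary.PropositionalEquality using (_≡_)
open import Relation.Nullary using (¬_)
open import Relation.Nullary.Decidable using (Dec; yes; no)
open import Function.Bundles using (_⇔_)

data Start (x y : ℕ) : ℕ → ℕ → Set where
  self : Start x y x y
  decX : ∀ {u} → x ≡ suc u → Start x y u y
  decY : ∀ {v} → y ≡ suc v → Start x y x v

data Option (x y : ℕ) : ℕ → ℕ → Set where
  row   : ∀ {x'} → x' < x → Option x y x' y
  col   : ∀ {y'} → y' < y → Option x y x y'
  diag  : ∀ {u v} (s : ℕ) → Start x y u v → s ≤ u → s ≤ v →
          Option x y (u ∸ s) (v ∸ s)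
  wrapL : ∀ {u v} (t : ℕ) → Start x y u v → u < v → 0 < t → t ≤ v ∸ u →
          Option x y t (v ∸ u ∸ t)
  wrapR : ∀ {u v} (t : ℕ) → Start x y u v → v < u → 0 < t → t ≤ u ∸ v →
          Option x y (u ∸ v ∸ t) t

Move : ℕ → ℕ → ℕ → ℕ → Set
Move x y x' y' = Option x y x' y' × ¬ (x' ≡ x × y' ≡ y)

-- P is the set of P-positions: a position is in P iff it has no move into P.
-- (Every move decreases x+y, so there is exactly one such P, and (0,0) ∈ P.)
IsPPositions : (ℕ → ℕ → Set) → Set
IsPPositions P = ∀ x y → P x y ⇔ (∀ x' y' → Move x y x' y' → ¬ P x' y')

data Letter : Set where
  a b c : Letter

τ : Letter → List Letter
τ a = a ∷ b ∷ []
τ b = a ∷ c ∷ []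
τ c = a ∷ []

τ* : List Letter → List Letter
τ* = concatMap τ

τ^ : ℕ → List Letter
τ^ zero = a ∷ []
τ^ (suc m) = τ* (τ^ m)

isNotB : (l : Letter) → Dec (¬ l ≡ b)
isNotB a = yes (λ ())
isNotB b = no (λ f → f _≡_.refl)
isNotB c = yes (λ ())

τ^-del-b : ℕ → List Letter
τ^-del-b m = filter isNotB (τ^ m)

-- 0-indexed lookup with a default (only used within range)
nth : List Letter → ℕ → Letter
nth [] _ = a
nth (l ∷ _) zero = l
nth (_ ∷ ls) (suc i) = nth ls i

-- t_b, indexed from 1: the j-th letter of t_b is the j-th letter of
-- (τ^m(a) with b deleted) for any m large enough; m = j + 2 suffices since
-- τ^m(a) contains |τ^(m-1)(a)| ≥ m letters a, and the words τ^m(a) are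
-- prefixes of one another.
tb : ℕ → Letter
tb j = nth (τ^-del-b (j + 2)) (j ∸ 1)

_==L_ : Letter → Letter → ℕ
a ==L a = 1
b ==L b = 1
c ==L c = 1
_ ==L _ = 0

count : (ℕ → Letter) → Letter → ℕ → ℕ
count w l zero = 0
count w l (suc j) = count w l j + (w (suc j) ==L l)

NthOcc : (ℕ → Letter) → Letter → ℕ → ℕ → Set
NthOcc w l n j = (1 ≤ j) × (w j ≡ l) × (count w l j ≡ n)

-- Index the Tribonacci word t from 0 and put A k = k + 1 + #b, X k = k + 1 + #a (counts
-- in t 0 ⋯ t (k-1)), B k = A k + 2 X k and Y k = A k + X k. Because t is the fixed point
-- of τ, A k and B k are the positions of the (k+1)-st a and c in t_b, so A and B split
-- the positive integers; the gaps of X are exactly the values Y j, so X and Y split them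
-- too. The claimed P-positions are Q = {(0,0)} ∪ {(A k, B k), (B k, A k)}. No move
-- joins two positions of Q: rook moves fail because A and B are complementary, and all
-- positions of Q have even coordinate sum, so a diagonal or wrap-around move between
-- them starts at (A k, B k) itself; a diagonal one then keeps the gap 2 X k, forcing the
-- null move, and a wrap-around one lands on coordinate sum 2 X k ≠ 2 Y j. Conversely from
-- (A k, y) with A k < y < B k, write y - A k = 2e or 2e + 1 with e < X k; then e = 0,
-- e = X j or e = Y j gives a diagonal move to (0,0), a diagonal move to (A j, B j) or a
-- wrap-around move to (A j, B j).
module Submission where

open import Defs
open import Data.Nat using (ℕ; _≤_; _<_)
open import Data.Product using (_×_; ∃-syntax)
open import Function.Bundles using (_⇔_)
open import Data.Nat using (zero; suc; _+_; _*_; _∸_; _≤′_; ≤′-refl; ≤′-step; z≤n; s≤s)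
open import Data.Nat.Properties
open import Data.Nat.Tactic.RingSolver using (solve-∀)
open import Data.List using (List; []; _∷_; _++_; length; filter)
open import Data.List.Properties
  using (++-assoc; ++-identityʳ; length-++; filter-++; filter-accept; concatMap-++)
open import Data.Product using (∃₂; _,_; proj₁; proj₂; swap)
open import Data.Sum using (_⊎_; inj₁; inj₂; map)
open import Data.Empty using (⊥; ⊥-elim)
open import Relation.Nullary using (¬_)
open import Relation.Binary using (tri<; tri≈; tri>)
open import Relation.Binary.PropositionalEquality
open import Function.Base using (_∘_)
open import Function.Bundles using (mk⇔; Equivalence)
open import Function.Properties.Equivalence using () renaming (trans to ⇔-trans)

a≢b : a ≢ b
a≢b ()

c≢b : c ≢ b
c≢b ()

-- The Tribonacci word

infix 4 _⊑_
_⊑_ : List Letter → List Letter → Set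
u ⊑ w = ∃[ r ] w ≡ u ++ r

⊑-refl : ∀ u → u ⊑ u
⊑-refl u = [] , sym (++-identityʳ u)

⊑-trans : ∀ {u v w} → u ⊑ v → v ⊑ w → u ⊑ w
⊑-trans {u} (r , refl) (r' , refl) = r ++ r' , ++-assoc u r r'

nth-⊑ : ∀ {u w} i → u ⊑ w → i < length u → nth w i ≡ nth u i
nth-⊑ {_ ∷ _} zero    (r , refl) _         = refl
nth-⊑ {_ ∷ u} (suc i) (r , refl) (s≤s i<) = nth-⊑ {u} i (r , refl) i<

nth-++ : ∀ u v i → nth (u ++ v) (length u + i) ≡ nth v i
nth-++ []      v i = refl
nth-++ (_ ∷ u) v i = nth-++ u v i

τ*-⊑ : ∀ {u w} → u ⊑ w → τ* u ⊑ τ* w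
τ*-⊑ {u} (r , refl) = τ* r , concatMap-++ τ u r

filter-⊑ : ∀ {u w} → u ⊑ w → filter isNotB u ⊑ filter isNotB w
filter-⊑ {u} (r , refl) = filter isNotB r , filter-++ isNotB u r

τ^-⊑-suc : ∀ m → τ^ m ⊑ τ^ (suc m)
τ^-⊑-suc zero    = b ∷ [] , refl
τ^-⊑-suc (suc m) = τ*-⊑ (τ^-⊑-suc m)

τ^-⊑ : ∀ {m n} → m ≤ n → τ^ m ⊑ τ^ n
τ^-⊑ m≤n = go (≤⇒≤′ m≤n)
  where
  go : ∀ {m n} → m ≤′ n → τ^ m ⊑ τ^ n
  go ≤′-refl        = ⊑-refl _
  go {n = suc n} (≤′-step m≤′n) = ⊑-trans (go m≤′n) (τ^-⊑-suc n)

occ : Letter → List Letter → ℕ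
occ l []      = 0
occ l (x ∷ u) = (x ==L l) + occ l u

length-τ* : ∀ u → length (τ* u) ≡ length u + occ a u + occ b u
length-τ* []      = refl
length-τ* (a ∷ u) = trans (cong (2 +_) (length-τ* u)) (rearrange (length u) (occ a u) (occ b u))
  where rearrange : ∀ n p q → 2 + (n + p + q) ≡ suc n + suc p + q
        rearrange = solve-∀
length-τ* (b ∷ u) = trans (cong (2 +_) (length-τ* u)) (rearrange (length u) (occ a u) (occ b u))
  where rearrange : ∀ n p q → 2 + (n + p + q) ≡ suc n + p + suc q
        rearrange = solve-∀
length-τ* (c ∷ u) = cong suc (length-τ* u)

occ-a-τ* : ∀ u → occ a (τ* u) ≡ length u
occ-a-τ* []      = refl
occ-a-τ* (a ∷ u) = cong suc (occ-a-τ* u)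
occ-a-τ* (b ∷ u) = cong suc (occ-a-τ* u)
occ-a-τ* (c ∷ u) = cong suc (occ-a-τ* u)

length-filter : ∀ u → length (filter isNotB u) ≡ occ a u + occ c u
length-filter []      = refl
length-filter (a ∷ u) = cong suc (length-filter u)
length-filter (b ∷ u) = length-filter u
length-filter (c ∷ u) = trans (cong suc (length-filter u)) (sym (+-suc _ _))

length-τ^ : ∀ m → m < length (τ^ m)
occ-a-τ^ : ∀ m → 1 ≤ occ a (τ^ m)

length-τ^ zero    = s≤s z≤n
length-τ^ (suc m) = begin-strict
  suc m                                       <⟨ s≤s (length-τ^ m) ⟩
  1 + length (τ^ m)                           ≤⟨ +-monoˡ-≤ _ (occ-a-τ^ m) ⟩
  occ a (τ^ m) + length (τ^ m)                ≡⟨ +-comm _ (length (τ^ m)) ⟩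
  length (τ^ m) + occ a (τ^ m)                ≤⟨ m≤m+n _ _ ⟩
  length (τ^ m) + occ a (τ^ m) + occ b (τ^ m) ≡⟨ length-τ* (τ^ m) ⟨
  length (τ^ (suc m))                         ∎
  where open ≤-Reasoning

occ-a-τ^ zero    = s≤s z≤n
occ-a-τ^ (suc m) = subst (1 ≤_) (sym (occ-a-τ* (τ^ m))) (≤-trans (s≤s z≤n) (length-τ^ m))

t : ℕ → Letter
t i = nth (τ^ (suc i)) i

TPrefix : List Letter → Set
TPrefix u = ∃[ K ] u ⊑ τ^ K

nth-agree : ∀ {u v w} i → u ⊑ w → v ⊑ w → i < length u → i < length v → nth u i ≡ nth v i
nth-agree i u⊑w v⊑w i<u i<v = trans (sym (nth-⊑ i u⊑w i<u)) (nth-⊑ i v⊑w i<v)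

nth-TPrefix : ∀ {u} → TPrefix u → ∀ i → i < length u → nth u i ≡ t i
nth-TPrefix (K , u⊑τ^K) i i<u =
  nth-agree i (⊑-trans u⊑τ^K (τ^-⊑ (m≤m+n K (suc i)))) (τ^-⊑ (m≤n+m (suc i) K))
            i<u (<-trans (n<1+n i) (length-τ^ (suc i)))

t-after : ∀ u v → TPrefix (u ++ v) → ∀ i → i < length v → t (length u + i) ≡ nth v i
t-after u v pre i i<v = trans (sym (nth-TPrefix pre (length u + i) bound)) (nth-++ u v i)
  where
  bound : length u + i < length (u ++ v)
  bound = subst (length u + i <_) (sym (length-++ u)) (+-monoʳ-< (length u) i<v)

split : ∀ w i → i < length w → ∃₂ λ u r → w ≡ u ++ nth w i ∷ r × length u ≡ i
split (x ∷ w) zero    _        = [] , w , refl , refl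
split (x ∷ w) (suc i) (s≤s i<) with split w i i<
... | u , r , eq , |u|≡i = x ∷ u , r , cong (x ∷_) eq , cong suc |u|≡i

τ^-split : ∀ m → ∃₂ λ u r → τ^ m ≡ u ++ t m ∷ r × length u ≡ m
τ^-split m with split (τ^ m) m (length-τ^ m)
... | u , r , eq , |u|≡m = u , r , trans eq (cong (λ x → u ++ x ∷ r) tm) , |u|≡m
  where tm : nth (τ^ m) m ≡ t m
        tm = nth-TPrefix (m , ⊑-refl (τ^ m)) m (length-τ^ m)

-- count reads a word indexed from 1
t₁ : ℕ → Letter
t₁ j = t (j ∸ 1)

tcount : Letter → ℕ → ℕ
tcount = count t₁

count-window : ∀ w l o v → (∀ i → i < length v → w (suc (o + i)) ≡ nth v i) →
           count w l (o + length v) ≡ count w l o + occ l v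
count-window w l o []      _     = trans (cong (count w l) (+-identityʳ o)) (sym (+-identityʳ _))
count-window w l o (x ∷ v) reads = begin
  count w l (o + suc (length v))          ≡⟨ cong (count w l) (+-suc o (length v)) ⟩
  count w l (suc o + length v)            ≡⟨ count-window w l (suc o) v reads-v ⟩
  count w l o + (w (suc o) ==L l) + occ l v
    ≡⟨ cong (λ y → count w l o + (y ==L l) + occ l v) w[1+o]≡x ⟩
  count w l o + (x ==L l) + occ l v       ≡⟨ +-assoc (count w l o) _ _ ⟩
  count w l o + occ l (x ∷ v)             ∎
  where
  open ≡-Reasoning
  reads-v : ∀ i → i < length v → w (suc (suc o + i)) ≡ nth v i
  reads-v i i< = trans (cong (λ j → w (suc j)) (sym (+-suc o i))) (reads (suc i) (s≤s i<))
  w[1+o]≡x : w (suc o) ≡ x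
  w[1+o]≡x = trans (cong (λ j → w (suc j)) (sym (+-identityʳ o))) (reads 0 (s≤s z≤n))

tcount-TPrefix : ∀ {u} → TPrefix u → ∀ l → tcount l (length u) ≡ occ l u
tcount-TPrefix {u} pre l = count-window t₁ l 0 u (λ i i< → sym (nth-TPrefix pre i i<))

-- L m is the length of τ (t 0 ⋯ t (m-1)), as |τ a| = |τ b| = 2 and |τ c| = 1.
L : ℕ → ℕ
L m = m + tcount a m + tcount b m

length-τ*-TPrefix : ∀ {u} → TPrefix u → length (τ* u) ≡ L (length u)
length-τ*-TPrefix {u} pre =
  trans (length-τ* u)
        (sym (cong₂ (λ p q → length u + p + q) (tcount-TPrefix pre a) (tcount-TPrefix pre b)))

-- t is a fixed point of τ: from position L m on, t spells τ (t m).
block : ∀ m i → i < length (τ (t m)) → t (L m + i) ≡ nth (τ (t m)) i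
block m i i< with τ^-split m
... | u , r , eq , |u|≡m =
  subst (λ n → t (n + i) ≡ nth (τ (t m)) i) |τ*u|≡Lm (t-after (τ* u) (τ (t m)) pre i i<)
  where
  pre : TPrefix (τ* u ++ τ (t m))
  pre = suc m , τ* r , trans (cong τ* eq)
                       (trans (concatMap-++ τ u (t m ∷ r)) (sym (++-assoc (τ* u) (τ (t m)) (τ* r))))
  |τ*u|≡Lm : length (τ* u) ≡ L m
  |τ*u|≡Lm = trans (length-τ*-TPrefix (m , t m ∷ r , eq)) (cong L |u|≡m)

t-L : ∀ m → t (L m) ≡ a
t-L m = trans (cong t (sym (+-identityʳ (L m)))) (trans (block m 0 (τ-nonempty (t m))) (τ-head (t m)))
  where
  τ-nonempty : ∀ x → 0 < length (τ x)
  τ-nonempty a = s≤s z≤n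
  τ-nonempty b = s≤s z≤n
  τ-nonempty c = s≤s z≤n
  τ-head : ∀ x → nth (τ x) 0 ≡ a
  τ-head a = refl
  τ-head b = refl
  τ-head c = refl

L-suc : ∀ m → L (suc m) ≡ L m + length (τ (t m))
L-suc m = rearrange (t m) m (tcount a m) (tcount b m)
  where rearrange : ∀ x n p q → suc n + (p + (x ==L a)) + (q + (x ==L b)) ≡ n + p + q + length (τ x)
        rearrange a = solve-∀
        rearrange b = solve-∀
        rearrange c = solve-∀

tcount-L-suc : ∀ l m → tcount l (L (suc m)) ≡ tcount l (L m) + occ l (τ (t m))
tcount-L-suc l m =
  trans (cong (tcount l) (L-suc m)) (count-window t₁ l (L m) (τ (t m)) (λ i i< → block m i i<))

tcount-a-L : ∀ m → tcount a (L m) ≡ m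
tcount-a-L zero    = refl
tcount-a-L (suc m) =
  trans (tcount-L-suc a m) (trans (cong (_+ occ a (τ (t m))) (tcount-a-L m)) (one-a (t m)))
  where one-a : ∀ x → m + occ a (τ x) ≡ suc m
        one-a a = +-comm m 1
        one-a b = +-comm m 1
        one-a c = +-comm m 1

tcount-b-L : ∀ m → tcount b (L m) ≡ tcount a m
tcount-b-L zero    = refl
tcount-b-L (suc m) = trans (tcount-L-suc b m) (cong₂ _+_ (tcount-b-L m) (b-from-a (t m)))
  where b-from-a : ∀ x → occ b (τ x) ≡ (x ==L a)
        b-from-a a = refl
        b-from-a b = refl
        b-from-a c = refl

tcount-c-L : ∀ m → tcount c (L m) ≡ tcount b m
tcount-c-L zero    = refl
tcount-c-L (suc m) = trans (tcount-L-suc c m) (cong₂ _+_ (tcount-c-L m) (c-from-b (t m)))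
  where c-from-b : ∀ x → occ c (τ x) ≡ (x ==L b)
        c-from-b a = refl
        c-from-b b = refl
        c-from-b c = refl

==L-refl : ∀ l → l ==L l ≡ 1
==L-refl a = refl
==L-refl b = refl
==L-refl c = refl

count-suc-hit : ∀ w l j → w (suc j) ≡ l → count w l (suc j) ≡ suc (count w l j)
count-suc-hit w l j refl = trans (cong (count w l j +_) (==L-refl (w (suc j)))) (+-comm _ 1)

count-mono : ∀ w l {i j} → i ≤ j → count w l i ≤ count w l j
count-mono w l i≤j = go (≤⇒≤′ i≤j)
  where
  go : ∀ {i j} → i ≤′ j → count w l i ≤ count w l j
  go ≤′-refl        = ≤-refl
  go (≤′-step i≤′j) = ≤-trans (go i≤′j) (m≤m+n _ _)

count-strict : ∀ w l {i j} → w (suc i) ≡ l → i < j → count w l i < count w l j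
count-strict w l {i} wi≡l i<j =
  ≤-trans (≤-reflexive (sym (count-suc-hit w l i wi≡l))) (count-mono w l i<j)

count-injective : ∀ w l {i j} → w (suc i) ≡ l → w (suc j) ≡ l →
                  count w l i ≡ count w l j → i ≡ j
count-injective w l {i} {j} wi≡l wj≡l eq with <-cmp i j
... | tri< i<j _ _ = ⊥-elim (<-irrefl eq (count-strict w l wi≡l i<j))
... | tri≈ _ i≡j _ = i≡j
... | tri> _ _ j<i = ⊥-elim (<-irrefl (sym eq) (count-strict w l wj≡l j<i))

NthOcc-unique : ∀ w l {n i j} → NthOcc w l n i → NthOcc w l n j → i ≡ j
NthOcc-unique w l {i = suc i} {suc j} (_ , wi≡l , ci≡n) (_ , wj≡l , cj≡n) =
  cong suc (count-injective w l wi≡l wj≡l (suc-injective (begin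
    suc (count w l i) ≡⟨ count-suc-hit w l i wi≡l ⟨
    count w l (suc i) ≡⟨ trans ci≡n (sym cj≡n) ⟩
    count w l (suc j) ≡⟨ count-suc-hit w l j wj≡l ⟩
    suc (count w l j) ∎)))
  where open ≡-Reasoning

-- The word t_b

nonB : ℕ → ℕ
nonB p = tcount a p + tcount c p

length-filter-τ^ : ∀ n → n < length (filter isNotB (τ^ (suc n + 2)))
length-filter-τ^ n = begin-strict
  n                                        ≤⟨ m≤m+n n 2 ⟩
  n + 2                                    <⟨ length-τ^ (n + 2) ⟩
  length (τ^ (n + 2))                      ≡⟨ occ-a-τ* (τ^ (n + 2)) ⟨
  occ a (τ^ (suc n + 2))                   ≤⟨ m≤m+n _ _ ⟩
  occ a (τ^ (suc n + 2)) + occ c (τ^ (suc n + 2)) ≡⟨ length-filter (τ^ (suc n + 2)) ⟨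
  length (filter isNotB (τ^ (suc n + 2)))  ∎
  where open ≤-Reasoning

nth-filter-TPrefix : ∀ {w} → TPrefix w → ∀ n → n < length (filter isNotB w) →
                     tb (suc n) ≡ nth (filter isNotB w) n
nth-filter-TPrefix (K , w⊑τ^K) n n< =
  nth-agree n (filter-⊑ (τ^-⊑ (m≤n+m (suc n + 2) K)))
              (filter-⊑ (⊑-trans w⊑τ^K (τ^-⊑ (m≤m+n K (suc n + 2)))))
              (length-filter-τ^ n) n<

tb-nonB : ∀ p → t p ≢ b → tb (suc (nonB p)) ≡ t p
tb-nonB p tp≢b with τ^-split p
... | u , r , eq , |u|≡p =
  subst (λ n → tb (suc n) ≡ t p) |fu|≡nonB
    (trans (nth-filter-TPrefix (p , ⊑-refl (τ^ p)) (length fu) bound) nth-at)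
  where
  fu : List Letter
  fu = filter isNotB u
  split-filter : filter isNotB (τ^ p) ≡ fu ++ t p ∷ filter isNotB r
  split-filter = trans (cong (filter isNotB) eq)
                       (trans (filter-++ isNotB u (t p ∷ r)) (cong (fu ++_) (filter-accept isNotB tp≢b)))
  nth-at : nth (filter isNotB (τ^ p)) (length fu) ≡ t p
  nth-at = trans (cong (λ w → nth w (length fu)) split-filter)
                 (trans (cong (nth (fu ++ t p ∷ filter isNotB r)) (sym (+-identityʳ _))) (nth-++ fu _ 0))
  bound : length fu < length (filter isNotB (τ^ p))
  bound = subst (length fu <_) (sym (trans (cong length split-filter) (length-++ fu)))
                (m<m+n (length fu) (s≤s z≤n))
  |fu|≡nonB : length fu ≡ nonB p
  |fu|≡nonB = trans (length-filter u)
                (trans (sym (cong₂ _+_ (tcount-TPrefix pre a) (tcount-TPrefix pre c))) (cong nonB |u|≡p))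
    where pre : TPrefix u
          pre = p , t p ∷ r , eq

nonB-suc : ∀ p → nonB (suc p) ≡ nonB p + ((t p ==L a) + (t p ==L c))
nonB-suc p = rearrange (tcount a p) (tcount c p) (t p ==L a) (t p ==L c)
  where rearrange : ∀ m n i j → m + i + (n + j) ≡ m + n + (i + j)
        rearrange = solve-∀

count-tb-nonB : ∀ l → l ≢ b → ∀ p → count tb l (nonB p) ≡ tcount l p
count-tb-nonB l l≢b zero    = refl
count-tb-nonB l l≢b (suc p) = trans (cong (count tb l) (nonB-suc p)) (step (t p) refl)
  where
  IH : count tb l (nonB p) ≡ tcount l p
  IH = count-tb-nonB l l≢b p
  kept : t p ≢ b → count tb l (nonB p + 1) ≡ tcount l p + (t p ==L l)
  kept tp≢b = begin
    count tb l (nonB p + 1)                           ≡⟨ cong (count tb l) (+-comm (nonB p) 1) ⟩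
    count tb l (nonB p) + (tb (suc (nonB p)) ==L l)   ≡⟨ cong₂ _+_ IH (cong (_==L l) (tb-nonB p tp≢b)) ⟩
    tcount l p + (t p ==L l)                          ∎
    where open ≡-Reasoning
  step : ∀ x → t p ≡ x → count tb l (nonB p + ((x ==L a) + (x ==L c))) ≡ tcount l p + (t p ==L l)
  step a tp≡a = kept (λ tp≡b → a≢b (trans (sym tp≡a) tp≡b))
  step c tp≡c = kept (λ tp≡b → c≢b (trans (sym tp≡c) tp≡b))
  step b tp≡b = begin
    count tb l (nonB p + 0)   ≡⟨ cong (count tb l) (+-identityʳ (nonB p)) ⟩
    count tb l (nonB p)       ≡⟨ IH ⟩
    tcount l p                ≡⟨ +-identityʳ (tcount l p) ⟨
    tcount l p + 0            ≡⟨ cong (tcount l p +_) (b-unmatched l l≢b) ⟨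
    tcount l p + (b ==L l)    ≡⟨ cong (λ x → tcount l p + (x ==L l)) tp≡b ⟨
    tcount l p + (t p ==L l)  ∎
    where
    open ≡-Reasoning
    b-unmatched : ∀ l → l ≢ b → (b ==L l) ≡ 0
    b-unmatched a _   = refl
    b-unmatched b b≢b = ⊥-elim (b≢b refl)
    b-unmatched c _   = refl

tb-occurrence : ∀ l p → t p ≡ l → l ≢ b → NthOcc tb l (suc (tcount l p)) (suc (nonB p))
tb-occurrence l p tp≡l l≢b =
  s≤s z≤n , tb≡l ,
  trans (count-suc-hit tb l (nonB p) tb≡l) (cong suc (count-tb-nonB l l≢b p))
  where tb≡l : tb (suc (nonB p)) ≡ l
        tb≡l = trans (tb-nonB p (λ tp≡b → l≢b (trans (sym tp≡l) tp≡b))) tp≡l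

nth-filter-not-b : ∀ w i → nth (filter isNotB w) i ≢ b
nth-filter-not-b []      i       ()
nth-filter-not-b (a ∷ w) zero    ()
nth-filter-not-b (a ∷ w) (suc i) = nth-filter-not-b w i
nth-filter-not-b (b ∷ w) i       = nth-filter-not-b w i
nth-filter-not-b (c ∷ w) zero    ()
nth-filter-not-b (c ∷ w) (suc i) = nth-filter-not-b w i

tb-not-b : ∀ j → tb j ≢ b
tb-not-b j = nth-filter-not-b (τ^ (j + 2)) (j ∸ 1)

-- The sequences A, B, X and Y

A X B Y : ℕ → ℕ
A k = suc k + tcount b k
X k = suc k + tcount a k
B k = A k + 2 * X k
Y k = A k + X k

tcount-after-L : ∀ l m → tcount l (suc (L m)) ≡ tcount l (L m) + (a ==L l)
tcount-after-L l m = cong (λ x → tcount l (L m) + (x ==L l)) (t-L m)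

t-L-suc : ∀ m x → t m ≡ x → 1 < length (τ x) → t (suc (L m)) ≡ nth (τ x) 1
t-L-suc m x refl 1< = trans (cong t (+-comm 1 (L m))) (block m 1 1<)

A-occurrence : ∀ k → NthOcc tb a (suc k) (A k)
A-occurrence k = subst₂ (NthOcc tb a) (cong suc (tcount-a-L k))
                   (cong suc (cong₂ _+_ (tcount-a-L k) (tcount-c-L k)))
                   (tb-occurrence a (L k) (t-L k) a≢b)

-- The c in τ(b) = ac, where the b is the one in τ(a) = ab, where a = t (L k).
B-occurrence : ∀ k → NthOcc tb c (suc k) (B k)
B-occurrence k = subst₂ (NthOcc tb c) (cong suc c-count) position (tb-occurrence c s ts c≢b)
  where
  q r s : ℕ
  q = L k
  r = suc (L q)
  s = suc (L r)
  ts : t s ≡ c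
  ts = t-L-suc r b (t-L-suc q a (t-L k) (s≤s (s≤s z≤n))) (s≤s (s≤s z≤n))
  c-count : tcount c s ≡ k
  c-count = begin
    tcount c s              ≡⟨ trans (tcount-after-L c r) (+-identityʳ _) ⟩
    tcount c (L r)          ≡⟨ tcount-c-L r ⟩
    tcount b r              ≡⟨ trans (tcount-after-L b q) (+-identityʳ _) ⟩
    tcount b (L q)          ≡⟨ tcount-b-L q ⟩
    tcount a q              ≡⟨ tcount-a-L k ⟩
    k                       ∎
    where open ≡-Reasoning
  position : suc (nonB s) ≡ B k
  position = begin
    suc (tcount a s + tcount c s)
      ≡⟨ cong suc (cong₂ _+_ (trans (tcount-after-L a r) (cong (_+ 1) (tcount-a-L r))) c-count) ⟩
    suc (r + 1 + k)
      ≡⟨ cong (λ n → suc (suc n + 1 + k)) (cong₂ (λ i j → q + i + j) (tcount-a-L k) (tcount-b-L k)) ⟩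
    suc (suc (q + k + tcount a k) + 1 + k)
      ≡⟨ rearrange k (tcount a k) (tcount b k) ⟩
    B k
      ∎
    where
    open ≡-Reasoning
    rearrange : ∀ k i j → suc (suc (k + i + j + k + i) + 1 + k) ≡ suc k + j + 2 * (suc k + i)
    rearrange = solve-∀

occurrence-at : ∀ w l j → w (suc j) ≡ l → NthOcc w l (suc (count w l j)) (suc j)
occurrence-at w l j wj≡l = s≤s z≤n , wj≡l , count-suc-hit w l j wj≡l

A-or-B : ∀ x → 1 ≤ x → (∃[ k ] A k ≡ x) ⊎ (∃[ k ] B k ≡ x)
A-or-B (suc j) _ = by-letter (tb (suc j)) refl
  where
  by-letter : ∀ l → tb (suc j) ≡ l → (∃[ k ] A k ≡ suc j) ⊎ (∃[ k ] B k ≡ suc j)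
  by-letter a tb≡a = inj₁ (count tb a j , NthOcc-unique tb a (A-occurrence _) (occurrence-at tb a j tb≡a))
  by-letter b tb≡b = ⊥-elim (tb-not-b (suc j) tb≡b)
  by-letter c tb≡c = inj₂ (count tb c j , NthOcc-unique tb c (B-occurrence _) (occurrence-at tb c j tb≡c))

A≢B : ∀ j k → A j ≢ B k
A≢B j k Aj≡Bk = a≢c (trans (sym (proj₁ (proj₂ (A-occurrence j))))
                           (trans (cong tb Aj≡Bk) (proj₁ (proj₂ (B-occurrence k)))))
  where a≢c : a ≢ c
        a≢c ()

Increasing : (ℕ → ℕ) → Set
Increasing f = ∀ k → f k < f (suc k)

module _ {f : ℕ → ℕ} (f↑ : Increasing f) where

  increasing-< : ∀ {j k} → j < k → f j < f k
  increasing-< {j} j<k = go (≤⇒≤′ j<k)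
    where
    go : ∀ {k} → suc j ≤′ k → f j < f k
    go ≤′-refl        = f↑ j
    go (≤′-step j<′k) = <-trans (go j<′k) (f↑ _)

  increasing-≤ : ∀ {j k} → j ≤ k → f j ≤ f k
  increasing-≤ j≤k with m≤n⇒m<n∨m≡n j≤k
  ... | inj₁ j<k  = <⇒≤ (increasing-< j<k)
  ... | inj₂ refl = ≤-refl

  increasing-injective : ∀ {j k} → f j ≡ f k → j ≡ k
  increasing-injective {j} {k} eq with <-cmp j k
  ... | tri< j<k _ _ = ⊥-elim (<-irrefl eq (increasing-< j<k))
  ... | tri≈ _ j≡k _ = j≡k
  ... | tri> _ _ k<j = ⊥-elim (<-irrefl (sym eq) (increasing-< k<j))

  increasing-reflects-< : ∀ {j k} → f j < f k → j < k
  increasing-reflects-< {j} {k} fj<fk with <-cmp j k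
  ... | tri< j<k _ _ = j<k
  ... | tri≈ _ refl _ = ⊥-elim (<-irrefl refl fj<fk)
  ... | tri> _ _ k<j = ⊥-elim (<-asym fj<fk (increasing-< k<j))

  increasing-skips : ∀ {n} → f (suc n) ≡ 2 + f n → ∀ m → f m ≢ suc (f n)
  increasing-skips {n} f[1+n]≡2+fn m eq with <-cmp m n
  ... | tri< m<n _ _ = <-asym (n<1+n (f n)) (subst (_< f n) eq (increasing-< m<n))
  ... | tri≈ _ refl _ = <-irrefl eq (n<1+n (f n))
  ... | tri> _ _ n<m = <-irrefl (sym eq) (begin-strict
        suc (f n)   <⟨ n<1+n _ ⟩
        2 + f n     ≡⟨ f[1+n]≡2+fn ⟨
        f (suc n)   ≤⟨ increasing-≤ n<m ⟩
        f m         ∎)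
    where open ≤-Reasoning

count-increasing : ∀ l → Increasing (λ k → suc k + tcount l k)
count-increasing l k = s≤s (s≤s (+-monoʳ-≤ k (m≤m+n _ _)))

A-increasing : Increasing A
A-increasing = count-increasing b

X-increasing : Increasing X
X-increasing = count-increasing a

B-increasing : Increasing B
B-increasing k = +-mono-<-≤ (A-increasing k) (*-monoʳ-≤ 2 (<⇒≤ (X-increasing k)))

X-suc : ∀ m → X (suc m) ≡ suc (X m) + (t m ==L a)
X-suc m = rearrange m (tcount a m) (t m ==L a)
  where rearrange : ∀ m i δ → suc (suc m) + (i + δ) ≡ suc (suc m + i) + δ
        rearrange = solve-∀

Y≡suc-X-L : ∀ k → Y k ≡ suc (X (L k))
Y≡suc-X-L k =
  trans (rearrange k (tcount a k) (tcount b k)) (cong (λ i → suc (suc (L k) + i)) (sym (tcount-a-L k)))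
  where rearrange : ∀ k i j → suc k + j + (suc k + i) ≡ suc (suc (k + i + j) + k)
        rearrange = solve-∀

L-tcount-a : ∀ m → t m ≡ a → L (tcount a m) ≡ m
L-tcount-a m tm≡a = count-injective t₁ a (t-L (tcount a m)) tm≡a (tcount-a-L (tcount a m))

X≢Y : ∀ j k → X j ≢ Y k
X≢Y j k Xj≡Yk = increasing-skips X-increasing {L k} X-skip j (trans Xj≡Yk (Y≡suc-X-L k))
  where X-skip : X (suc (L k)) ≡ 2 + X (L k)
        X-skip = trans (X-suc (L k))
                       (trans (cong (λ x → suc (X (L k)) + (x ==L a)) (t-L k)) (+-comm (suc (X (L k))) 1))

X-or-Y : ∀ h → 1 ≤ h → (∃[ j ] X j ≡ h) ⊎ (∃[ j ] Y j ≡ h)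
X-or-Y h 1≤h = below h (s≤s (m≤m+n h _))
  where
  between : ∀ m → X m < h → h < X (suc m) → ∃[ j ] Y j ≡ h
  between m Xm<h h<X[1+m] = by-letter (t m) refl
    where
    X[1+m]≡ : ∀ {x} → t m ≡ x → X (suc m) ≡ suc (X m) + (x ==L a)
    X[1+m]≡ tm≡x = trans (X-suc m) (cong (λ x → suc (X m) + (x ==L a)) tm≡x)
    no-room : ∀ {x} → t m ≡ x → (x ==L a) ≡ 0 → ⊥
    no-room tm≡x δ≡0 = <-irrefl refl (≤-trans Xm<h (≤-pred (subst (h <_) X[1+m]≡1+Xm h<X[1+m])))
      where X[1+m]≡1+Xm : X (suc m) ≡ suc (X m)
            X[1+m]≡1+Xm = trans (X[1+m]≡ tm≡x) (trans (cong (suc (X m) +_) δ≡0) (+-identityʳ _))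
    by-letter : ∀ x → t m ≡ x → ∃[ j ] Y j ≡ h
    by-letter b tm≡b = ⊥-elim (no-room tm≡b refl)
    by-letter c tm≡c = ⊥-elim (no-room tm≡c refl)
    by-letter a tm≡a = tcount a m , (begin
      Y (tcount a m)             ≡⟨ Y≡suc-X-L (tcount a m) ⟩
      suc (X (L (tcount a m)))   ≡⟨ cong (λ n → suc (X n)) (L-tcount-a m tm≡a) ⟩
      suc (X m)                  ≡⟨ ≤-antisym Xm<h (≤-pred (subst (h <_) X[1+m]≡2+Xm h<X[1+m])) ⟩
      h                          ∎)
      where
      open ≡-Reasoning
      X[1+m]≡2+Xm : X (suc m) ≡ 2 + X m
      X[1+m]≡2+Xm = trans (X[1+m]≡ tm≡a) (+-comm _ 1)
  below : ∀ m → h < X m → (∃[ j ] X j ≡ h) ⊎ (∃[ j ] Y j ≡ h)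
  below zero    h<1 = ⊥-elim (<-irrefl refl (<-≤-trans h<1 1≤h))
  below (suc m) h< with <-cmp h (X m)
  ... | tri< h<Xm _ _ = below m h<Xm
  ... | tri≈ _ h≡Xm _ = inj₁ (m , sym h≡Xm)
  ... | tri> _ _ Xm<h = inj₂ (between m Xm<h h<)

Even : ℕ → Set
Even n = ∃[ e ] n ≡ 2 * e

Even-suc : ∀ {n} → Even n → ¬ Even (suc n)
Even-suc (e , refl) (f , eq) = even≢odd f e (sym eq)

Even-+ : ∀ {m} k → Even m → Even (m + 2 * k)
Even-+ k (e , refl) = e + k , sym (*-distribˡ-+ 2 e k)

even-or-odd : ∀ n → ∃[ e ] (n ≡ 2 * e ⊎ n ≡ suc (2 * e))
even-or-odd zero = 0 , inj₁ refl
even-or-odd (suc n) with even-or-odd n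
... | e , inj₁ n≡2e   = e , inj₂ (cong suc n≡2e)
... | e , inj₂ n≡1+2e = suc e , inj₁ (trans (cong suc n≡1+2e) (sym (*-distribˡ-+ 2 1 e)))

-- The candidate set of P-positions

data Q : ℕ → ℕ → Set where
  origin : Q 0 0
  AB     : ∀ k → Q (A k) (B k)
  BA     : ∀ k → Q (B k) (A k)

Q-swap : ∀ {x y} → Q x y → Q y x
Q-swap origin = origin
Q-swap (AB k) = BA k
Q-swap (BA k) = AB k

Q-axis : ∀ {y} → Q 0 y → y ≡ 0
Q-axis origin = refl

A<B : ∀ k → A k < B k
A<B k = m<m+n (A k) (s≤s z≤n)

A+B≡2Y : ∀ k → A k + B k ≡ 2 * Y k
A+B≡2Y k = rearrange (A k) (X k)
  where rearrange : ∀ α ξ → α + (α + 2 * ξ) ≡ 2 * (α + ξ)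
        rearrange = solve-∀

Q-sum : ∀ {p q} → Q p q → 0 < p → ∃[ j ] p + q ≡ 2 * Y j
Q-sum (AB k) _ = k , A+B≡2Y k
Q-sum (BA k) _ = k , trans (+-comm (B k) (A k)) (A+B≡2Y k)

Q-even : ∀ {p q} → Q p q → Even (p + q)
Q-even origin = 0 , refl
Q-even (AB k) = Y k , A+B≡2Y k
Q-even (BA k) = Y k , trans (+-comm (B k) (A k)) (A+B≡2Y k)

Q-gap : ∀ {p q d} → Q p q → q ≡ p + 2 * d → 0 < d → ∃[ j ] p ≡ A j × d ≡ X j
Q-gap origin ()  (s≤s _)
Q-gap (AB j) gap _ = j , refl , sym (*-cancelˡ-≡ (X j) _ 2 (+-cancelˡ-≡ (A j) _ _ gap))
Q-gap {d = d} (BA j) gap _ =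
  ⊥-elim (<⇒≱ (A<B j) (≤-trans (m≤m+n (B j) (2 * d)) (≤-reflexive (sym gap))))

Q-partner-A : ∀ {p q k} → Q p q → p ≡ A k → q ≡ B k
Q-partner-A origin ()
Q-partner-A {k = k} (AB j) Aj≡Ak = cong B (increasing-injective A-increasing {j} {k} Aj≡Ak)
Q-partner-A {k = k} (BA j) Bj≡Ak = ⊥-elim (A≢B k j (sym Bj≡Ak))

Q-partner-B : ∀ {p q k} → Q p q → q ≡ B k → p ≡ A k
Q-partner-B origin ()
Q-partner-B {k = k} (AB j) Bj≡Bk = cong A (increasing-injective B-increasing {j} {k} Bj≡Bk)
Q-partner-B {k = k} (BA j) Aj≡Bk = ⊥-elim (A≢B j k Aj≡Bk)

-- Queen moves

Start-swap : ∀ {x y u v} → Start x y u v → Start y x v u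
Start-swap self       = self
Start-swap (decX eq)  = decY eq
Start-swap (decY eq)  = decX eq

Option-swap : ∀ {x y p q} → Option x y p q → Option y x q p
Option-swap (row p<x)              = col p<x
Option-swap (col q<y)              = row q<y
Option-swap (diag s st s≤u s≤v)    = diag s (Start-swap st) s≤v s≤u
Option-swap (wrapL t st u<v 0<t t≤) = wrapR t (Start-swap st) u<v 0<t t≤
Option-swap (wrapR t st v<u 0<t t≤) = wrapL t (Start-swap st) v<u 0<t t≤

Move-swap : ∀ {x y p q} → Move x y p q → Move y x q p
Move-swap (o , ne) = Option-swap o , ne ∘ swap

Start-≤ : ∀ {x y u v} → Start x y u v → u ≤ x × v ≤ y
Start-≤ self        = ≤-refl , ≤-refl
Start-≤ (decX refl) = n≤1+n _ , ≤-refl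
Start-≤ (decY refl) = ≤-refl , n≤1+n _

∸-+-double : ∀ {w z} → w ≤ z → (z ∸ w) + 2 * w ≡ z + w
∸-+-double {w} {z} w≤z = begin
  (z ∸ w) + (w + (w + 0))  ≡⟨ cong ((z ∸ w) +_) (cong (w +_) (+-identityʳ w)) ⟩
  (z ∸ w) + (w + w)        ≡⟨ +-assoc (z ∸ w) w w ⟨
  (z ∸ w) + w + w          ≡⟨ cong (_+ w) (m∸n+n≡m w≤z) ⟩
  z + w                    ∎
  where open ≡-Reasoning

diag-sum : ∀ {u v s} → s ≤ u → s ≤ v → (u ∸ s) + (v ∸ s) + 2 * s ≡ u + v
diag-sum {u} {v} {s} s≤u s≤v = begin
  (u ∸ s) + (v ∸ s) + 2 * s    ≡⟨ rearrange (u ∸ s) (v ∸ s) s ⟩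
  ((u ∸ s) + s) + ((v ∸ s) + s) ≡⟨ cong₂ _+_ (m∸n+n≡m s≤u) (m∸n+n≡m s≤v) ⟩
  u + v                        ∎
  where
  open ≡-Reasoning
  rearrange : ∀ p q s → p + q + 2 * s ≡ (p + s) + (q + s)
  rearrange = solve-∀

wrapL-sum : ∀ {u v t} → u < v → t ≤ v ∸ u → t + (v ∸ u ∸ t) + 2 * u ≡ u + v
wrapL-sum {u} {v} u<v t≤ =
  trans (cong (_+ 2 * u) (m+[n∸m]≡n t≤)) (trans (∸-+-double (<⇒≤ u<v)) (+-comm v u))

wrapR-sum : ∀ {u v t} → v < u → t ≤ u ∸ v → (u ∸ v ∸ t) + t + 2 * v ≡ u + v
wrapR-sum {u} {v} v<u t≤ = trans (cong (_+ 2 * v) (m∸n+n≡m t≤)) (∸-+-double (<⇒≤ v<u))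

even-start : ∀ {x y u v} → Start x y u v → Even (x + y) → Even (u + v) → u ≡ x × v ≡ y
even-start self        _      _     = refl , refl
even-start (decX refl) even   even′ = ⊥-elim (Even-suc even′ even)
even-start {x} (decY {v} refl) even even′ =
  ⊥-elim (Even-suc even′ (subst Even (+-suc x v) even))

∸-fixed : ∀ {m s} → s ≤ m → m ∸ s ≡ m → s ≡ 0
∸-fixed {m} {s} s≤m eq = +-cancelˡ-≡ m s 0 (begin
  m + s        ≡⟨ cong (_+ s) eq ⟨
  (m ∸ s) + s  ≡⟨ m∸n+n≡m s≤m ⟩
  m            ≡⟨ +-identityʳ m ⟨
  m + 0        ∎)
  where open ≡-Reasoning

AB-independent : ∀ k {p q} → Move (A k) (B k) p q → ¬ Q p q
AB-independent k (row p<A , _) Qpq = <-irrefl (Q-partner-B {k = k} Qpq refl) p<A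
AB-independent k (col q<B , _) Qpq = <-irrefl (Q-partner-A {k = k} Qpq refl) q<B
AB-independent k (diag s st s≤u s≤v , ne) Qpq
  with even-start st (Q-even (AB k)) (subst Even (diag-sum s≤u s≤v) (Even-+ s (Q-even Qpq)))
... | refl , refl with Q-gap Qpq (+-∸-comm (2 * X k) s≤u) (s≤s z≤n)
...   | j , Ak∸s≡Aj , Xk≡Xj = ne (cong (A k ∸_) s≡0 , cong (B k ∸_) s≡0)
  where
  s≡0 : s ≡ 0
  s≡0 = ∸-fixed s≤u (trans Ak∸s≡Aj (cong A (increasing-injective X-increasing {j} {k} (sym Xk≡Xj))))
AB-independent k (wrapL {u} t st u<v 0<t t≤ , _) Qpq
  with even-start st (Q-even (AB k)) (subst Even (wrapL-sum u<v t≤) (Even-+ u (Q-even Qpq)))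
... | refl , refl with Q-sum Qpq 0<t
...   | j , sum≡2Yj = X≢Y k j (*-cancelˡ-≡ (X k) (Y j) 2 (begin
  2 * X k                 ≡⟨ m+n∸m≡n (A k) (2 * X k) ⟨
  B k ∸ A k               ≡⟨ m+[n∸m]≡n t≤ ⟨
  t + (B k ∸ A k ∸ t)     ≡⟨ sum≡2Yj ⟩
  2 * Y j                 ∎))
  where open ≡-Reasoning
AB-independent k (wrapR {v = v} t st v<u _ t≤ , _) Qpq
  with even-start st (Q-even (AB k)) (subst Even (wrapR-sum v<u t≤) (Even-+ v (Q-even Qpq)))
... | refl , refl = <-asym (A<B k) v<u

origin-stuck : ∀ {p q} → ¬ Move 0 0 p q
origin-stuck (row ()                    , _)
origin-stuck (col ()                    , _)
origin-stuck (diag _ self z≤n z≤n       , ne) = ne (refl , refl)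
origin-stuck (diag _ (decX ()) _ _      , _)
origin-stuck (diag _ (decY ()) _ _      , _)
origin-stuck (wrapL _ self () _ _       , _)
origin-stuck (wrapL _ (decX ()) _ _ _   , _)
origin-stuck (wrapL _ (decY ()) _ _ _   , _)
origin-stuck (wrapR _ self () _ _       , _)
origin-stuck (wrapR _ (decX ()) _ _ _   , _)
origin-stuck (wrapR _ (decY ()) _ _ _   , _)

Q-independent : ∀ {x y p q} → Q x y → Move x y p q → ¬ Q p q
Q-independent origin mv     _   = origin-stuck mv
Q-independent (AB k) mv     Qpq = AB-independent k mv Qpq
Q-independent (BA k) mv     Qpq = AB-independent k (Move-swap mv) (Q-swap Qpq)

diag-≤ : ∀ {u v s} → s ≤ u → s ≤ v → (u ∸ s) + (v ∸ s) ≤ u + v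
diag-≤ {u} {v} {s} s≤u s≤v = subst ((u ∸ s) + (v ∸ s) ≤_) (diag-sum s≤u s≤v) (m≤m+n _ (2 * s))

diag-< : ∀ {u v s} → 0 < s → s ≤ u → s ≤ v → (u ∸ s) + (v ∸ s) < u + v
diag-< {u} {v} {suc s} _ s≤u s≤v =
  subst ((u ∸ suc s) + (v ∸ suc s) <_) (diag-sum s≤u s≤v) (m<m+n _ (s≤s z≤n))

move-decreases : ∀ {x y p q} → 1 ≤ x → 1 ≤ y → Move x y p q → p + q < x + y
move-decreases {y = y} _ _ (row p<x , _) = +-monoˡ-< y p<x
move-decreases {x} _ _ (col q<y , _) = +-monoʳ-< x q<y
move-decreases _ _ (diag zero    self _ _ , ne)       = ⊥-elim (ne (refl , refl))
move-decreases _ _ (diag (suc s) self s≤u s≤v , _)    = diag-< (s≤s z≤n) s≤u s≤v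
move-decreases _ _ (diag s (decX refl) s≤u s≤v , _)   = ≤-<-trans (diag-≤ s≤u s≤v) (n<1+n _)
move-decreases {x} _ _ (diag {v = v} s (decY refl) s≤u s≤v , _) =
  ≤-<-trans (diag-≤ s≤u s≤v) (+-monoʳ-< x (n<1+n v))
move-decreases {y = y} 1≤x _ (wrapL {u} {v} t st u<v _ t≤ , _) =
  ≤-<-trans (≤-trans (≤-reflexive (m+[n∸m]≡n t≤)) (≤-trans (m∸n≤m v u) (proj₂ (Start-≤ st))))
            (m<n+m y 1≤x)
move-decreases {x} _ 1≤y (wrapR {u} {v} t st v<u _ t≤ , _) =
  ≤-<-trans (≤-trans (≤-reflexive (m∸n+n≡m t≤)) (≤-trans (m∸n≤m u v) (proj₁ (Start-≤ st))))
            (m<m+n x 1≤y)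

MoveToQ : ℕ → ℕ → Set
MoveToQ x y = ∃₂ λ p q → Move x y p q × Q p q

MoveToQ-swap : ∀ {x y} → MoveToQ y x → MoveToQ x y
MoveToQ-swap (p , q , mv , Qpq) = q , p , Move-swap mv , Q-swap Qpq

diag-to : ∀ {x y u v p q} → Start x y u v → ∀ s → s ≤ u → s ≤ v →
          u ∸ s ≡ p → v ∸ s ≡ q → Option x y p q
diag-to st s s≤u s≤v refl refl = diag s st s≤u s≤v

wrapL-to : ∀ {x y u v q} → Start x y u v → ∀ t → u < v → 0 < t → t ≤ v ∸ u →
           v ∸ u ∸ t ≡ q → Option x y t q
wrapL-to st t u<v 0<t t≤ refl = wrapL t st u<v 0<t t≤

move-from-even-start : ∀ k e {y} → Start (A k) y (A k) (A k + 2 * e) → A k + 2 * e ≤ y → e < X k →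
                       MoveToQ (A k) y
move-from-even-start k zero st _ _ =
  0 , 0 , (diag-to st (A k) ≤-refl (m≤m+n (A k) 0) (n∸n≡0 (A k)) (m+n∸m≡n (A k) 0) , λ { (() , _) }) ,
  origin
move-from-even-start k e@(suc _) {y} st v≤y e<Xk with X-or-Y e (s≤s z≤n)
... | inj₁ (j , Xj≡e) =
  A j , B j , (diag-to st (A k ∸ A j) Ak∸Aj≤Ak (≤-trans Ak∸Aj≤Ak (m≤m+n (A k) (2 * e)))
                          (m∸[m∸n]≡n (<⇒≤ Aj<Ak)) landing , ne) , AB j
  where
  Aj<Ak : A j < A k
  Aj<Ak = increasing-< A-increasing (increasing-reflects-< X-increasing {j} {k} (subst (_< X k) (sym Xj≡e) e<Xk))
  Ak∸Aj≤Ak : A k ∸ A j ≤ A k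
  Ak∸Aj≤Ak = m∸n≤m (A k) (A j)
  landing : A k + 2 * e ∸ (A k ∸ A j) ≡ B j
  landing = begin
    A k + 2 * e ∸ (A k ∸ A j)    ≡⟨ +-∸-comm (2 * e) Ak∸Aj≤Ak ⟩
    A k ∸ (A k ∸ A j) + 2 * e    ≡⟨ cong₂ _+_ (m∸[m∸n]≡n (<⇒≤ Aj<Ak)) (cong (2 *_) (sym Xj≡e)) ⟩
    B j                          ∎
    where open ≡-Reasoning
  ne : ¬ (A j ≡ A k × B j ≡ y)
  ne (Aj≡Ak , _) = <-irrefl Aj≡Ak Aj<Ak
... | inj₂ (j , Yj≡e) =
  A j , B j , (wrapL-to st (A j) (m<m+n (A k) (s≤s z≤n)) (s≤s z≤n) Aj≤ landing , ne) , AB j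
  where
  width : A k + 2 * e ∸ A k ≡ A j + B j
  width = trans (m+n∸m≡n (A k) (2 * e)) (trans (cong (2 *_) (sym Yj≡e)) (sym (A+B≡2Y j)))
  Aj≤ : A j ≤ A k + 2 * e ∸ A k
  Aj≤ = subst (A j ≤_) (sym width) (m≤m+n (A j) (B j))
  landing : A k + 2 * e ∸ A k ∸ A j ≡ B j
  landing = trans (cong (_∸ A j) width) (m+n∸m≡n (A j) (B j))
  ne : ¬ (A j ≡ A k × B j ≡ y)
  ne (Aj≡Ak , Bj≡y) = <-irrefl (trans (sym width′) (cong₂ _+_ Aj≡Ak Bj≡y)) 2e<Ak+y
    where
    width′ : A j + B j ≡ 2 * e
    width′ = trans (sym width) (m+n∸m≡n (A k) (2 * e))
    2e<Ak+y : 2 * e < A k + y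
    2e<Ak+y = ≤-<-trans (≤-trans (m≤n+m (2 * e) (A k)) v≤y) (m<n+m y (s≤s z≤n))

below-B : ∀ {k e} → A k + 2 * e < B k → e < X k
below-B {k} {e} lt = *-cancelˡ-< 2 e (X k) (+-cancelˡ-< (A k) (2 * e) (2 * X k) lt)

complete-≤ : ∀ {x y} → 1 ≤ x → x ≤ y → Q x y ⊎ MoveToQ x y
complete-≤ {x} {y} 1≤x x≤y with A-or-B x 1≤x
... | inj₂ (k , refl) = inj₂ (B k , A k , (col Ak<y , λ (_ , Ak≡y) → <-irrefl Ak≡y Ak<y) , BA k)
  where Ak<y : A k < y
        Ak<y = <-≤-trans (A<B k) x≤y
... | inj₁ (k , refl) with <-cmp y (B k)
...   | tri≈ _ y≡Bk _ = inj₁ (subst (Q (A k)) (sym y≡Bk) (AB k))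
...   | tri> _ _ Bk<y = inj₂ (A k , B k , (col Bk<y , λ (_ , Bk≡y) → <-irrefl Bk≡y Bk<y) , AB k)
...   | tri< y<Bk _ _ with even-or-odd (y ∸ A k)
...     | e , inj₁ d≡2e = inj₂ (move-from-even-start k e (subst (Start (A k) y (A k)) y≡ self)
                                  (≤-reflexive (sym y≡)) (below-B {k} (subst (_< B k) y≡ y<Bk)))
  where y≡ : y ≡ A k + 2 * e
        y≡ = trans (sym (m+[n∸m]≡n x≤y)) (cong (A k +_) d≡2e)
...     | e , inj₂ d≡1+2e = inj₂ (move-from-even-start k e (decY y≡)
                                    (≤-trans (n≤1+n _) (≤-reflexive (sym y≡)))
                                    (below-B {k} (<-trans (n<1+n _) (subst (_< B k) y≡ y<Bk))))
  where y≡ : y ≡ suc (A k + 2 * e)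
        y≡ = trans (sym (m+[n∸m]≡n x≤y)) (trans (cong (A k +_) d≡1+2e) (+-suc (A k) (2 * e)))

complete : ∀ x y → Q x y ⊎ MoveToQ x y
complete zero    zero    = inj₁ origin
complete zero    (suc y) = inj₂ (0 , 0 , (col (s≤s z≤n) , λ { (_ , ()) }) , origin)
complete (suc x) zero    = inj₂ (0 , 0 , (row (s≤s z≤n) , λ { (() , _) }) , origin)
complete (suc x) (suc y) with ≤-total (suc x) (suc y)
... | inj₁ x≤y = complete-≤ (s≤s z≤n) x≤y
... | inj₂ y≤x = map Q-swap MoveToQ-swap (complete-≤ (s≤s z≤n) y≤x)

module _ (P : ℕ → ℕ → Set) (isP : IsPPositions P) where
  open Equivalence

  P-origin : P 0 0
  P-origin = from (isP 0 0) (λ _ _ mv _ → origin-stuck mv)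

  -- Moves from positions with a zero coordinate need not decrease x + y, but such
  -- positions other than the origin move to the origin.
  P⇔Q-bounded : ∀ n x y → x + y ≤ n → P x y ⇔ Q x y
  P⇔Q-bounded _ zero zero _ = mk⇔ (λ _ → origin) (λ _ → P-origin)
  P⇔Q-bounded _ zero (suc y) _ =
    mk⇔ (λ P0y → ⊥-elim (to (isP 0 (suc y)) P0y 0 0 (col (s≤s z≤n) , λ { (_ , ()) }) P-origin))
        (λ Q0y → ⊥-elim (1+n≢0 (Q-axis Q0y)))
  P⇔Q-bounded _ (suc x) zero _ =
    mk⇔ (λ Px0 → ⊥-elim (to (isP (suc x) 0) Px0 0 0 (row (s≤s z≤n) , λ { (() , _) }) P-origin))
        (λ Qx0 → ⊥-elim (1+n≢0 (Q-axis (Q-swap Qx0))))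
  P⇔Q-bounded (suc n) (suc x) (suc y) x+y≤ = mk⇔ P⇒Q Q⇒P
    where
    IH : ∀ {p q} → Move (suc x) (suc y) p q → P p q ⇔ Q p q
    IH mv = P⇔Q-bounded n _ _ (≤-pred (≤-trans (move-decreases (s≤s z≤n) (s≤s z≤n) mv) x+y≤))
    P⇒Q : P (suc x) (suc y) → Q (suc x) (suc y)
    P⇒Q Pxy with complete (suc x) (suc y)
    ... | inj₁ Qxy = Qxy
    ... | inj₂ (p , q , mv , Qpq) = ⊥-elim (to (isP _ _) Pxy p q mv (from (IH mv) Qpq))
    Q⇒P : Q (suc x) (suc y) → P (suc x) (suc y)
    Q⇒P Qxy = from (isP _ _) (λ p q mv Ppq → Q-independent Qxy mv (to (IH mv) Ppq))

  P⇔Q : ∀ x y → P x y ⇔ Q x y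
  P⇔Q x y = P⇔Q-bounded (x + y) x y ≤-refl

Q⇒occurrences : ∀ {x y} → 0 < x → x ≤ y → Q x y →
                ∃[ n ] (1 ≤ n × NthOcc tb a n x × NthOcc tb c n y)
Q⇒occurrences () _ origin
Q⇒occurrences _ _ (AB k) = suc k , s≤s z≤n , A-occurrence k , B-occurrence k
Q⇒occurrences _ Bk≤Ak (BA k) = ⊥-elim (<⇒≱ (A<B k) Bk≤Ak)

occurrences⇒Q : ∀ {x y} → ∃[ n ] (1 ≤ n × NthOcc tb a n x × NthOcc tb c n y) → Q x y
occurrences⇒Q (suc k , _ , occ-x , occ-y) =
  subst₂ Q (NthOcc-unique tb a (A-occurrence k) occ-x) (NthOcc-unique tb c (B-occurrence k) occ-y) (AB k)

theorem2 : (P : ℕ → ℕ → Set) → IsPPositions P →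
    ∀ x y → 0 < x → x ≤ y →
      (P x y ⇔ (∃[ n ] (1 ≤ n × NthOcc tb a n x × NthOcc tb c n y)))
theorem2 P isP x y 0<x x≤y =
  ⇔-trans (P⇔Q P isP x y) (mk⇔ (Q⇒occurrences 0<x x≤y) occurrences⇒Q)
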